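{- Let $r\geq 3$ be an odd integer and let $$\phi_r(x,y,z)=\frac{x^r+y^r+z^r+(x+y+z)^r}{(x+y)(x+z)(y+z)}$$ as a polynomial over a field of characteristic $2$. Then $x+y$ does not divide $\phi_r(x,y,z)$.
   Context: All polynomials are over a field of characteristic $2$ (e.g. $\mathbb{F}_2$ or $\mathbb{F}_q$ with $q$ a power of $2$); in this characteristic $(x+y)(x+z)(y+z)$ divides $x^r+y^r+z^r+(x+y+z)^r$. -}

module Defs where

open import Level using (Level; _⊔_)
open import Algebra.Bundles using (CommutativeRing)
open import Data.Nat as ℕ using (ℕ; zero; suc; _∸_; _≤_)
open import Data.Sum using (_⊎_)
open import Data.Product using (Σ; ∃; _×_)
open import Relation.Nullary using (¬_)

record IsField {c ℓ : Level} (R : CommutativeRing c ℓ) : Set (c ⊔ ℓ) where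
  open CommutativeRing R
  field
    1≉0     : ¬ (1# ≈ 0#)
    inverse : ∀ x → ¬ (x ≈ 0#) → ∃ λ y → (x * y) ≈ 1#

HasChar2 : {c ℓ : Level} → CommutativeRing c ℓ → Set ℓ
HasChar2 R = let open CommutativeRing R in (1# + 1#) ≈ 0#

-- Polynomials in three variables x, y, z over R, represented by their
-- coefficient functions: (coeff i j k) is the coefficient of x^i y^j z^k.
module Poly3 {c ℓ : Level} (R : CommutativeRing c ℓ) where
  open CommutativeRing R renaming (Carrier to A)

  Coeffs : Set c
  Coeffs = ℕ → ℕ → ℕ → A

  IsPoly : Coeffs → Set ℓ
  IsPoly p = ∃ λ d → ∀ i j k → (d ≤ i) ⊎ (d ≤ j) ⊎ (d ≤ k) → p i j k ≈ 0#

  infix 4 _≋_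
  _≋_ : Coeffs → Coeffs → Set ℓ
  p ≋ q = ∀ i j k → p i j k ≈ q i j k

  sumTo : ℕ → (ℕ → A) → A
  sumTo zero    f = f 0
  sumTo (suc n) f = sumTo n f + f (suc n)

  infixl 6 _⊕_
  infixl 7 _⊗_
  infixr 8 _^^_

  _⊕_ : Coeffs → Coeffs → Coeffs
  (p ⊕ q) i j k = p i j k + q i j k

  _⊗_ : Coeffs → Coeffs → Coeffs
  (p ⊗ q) i j k =
    sumTo i λ a → sumTo j λ b → sumTo k λ e → p a b e * q (i ∸ a) (j ∸ b) (k ∸ e)

  isOne : ℕ → A
  isOne zero    = 0#
  isOne (suc zero) = 1#
  isOne (suc (suc _)) = 0#

  isZero : ℕ → A
  isZero zero    = 1#
  isZero (suc _) = 0#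

  one : Coeffs
  one i j k = isZero i * isZero j * isZero k

  X Y Z : Coeffs
  X i j k = isOne i * isZero j * isZero k
  Y i j k = isZero i * isOne j * isZero k
  Z i j k = isZero i * isZero j * isOne k

  _^^_ : Coeffs → ℕ → Coeffs
  p ^^ zero  = one
  p ^^ suc n = p ⊗ (p ^^ n)

  _∣P_ : Coeffs → Coeffs → Set (c ⊔ ℓ)
  d ∣P p = Σ Coeffs λ q → IsPoly q × (p ≋ d ⊗ q)

  numer : ℕ → Coeffs
  numer r = X ^^ r ⊕ Y ^^ r ⊕ Z ^^ r ⊕ (X ⊕ Y ⊕ Z) ^^ r

  denom : Coeffs
  denom = (X ⊕ Y) ⊗ (X ⊕ Z) ⊗ (Y ⊕ Z)

  -- φ is φ_r, i.e. the polynomial with denom · φ = numer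
  -- (the quotient exists and is unique since R[x,y,z] is a domain)
  IsPhi : ℕ → Coeffs → Set ℓ
  IsPhi r φ = IsPoly φ × (denom ⊗ φ ≋ numer r)

{-# OPTIONS --safe #-}
-- Let D be the derivation f ↦ (∂f/∂x)(1,1,0). Both x+y and x+y+z vanish at
-- (1,1,0) in characteristic 2. If x+y divided φ_r, then (x+y)² would divide
-- (x+y)(x+z)(y+z)φ_r, which D therefore kills. On the numerator, D gives
-- r·1 + r·(1+1+0)^(r-1) = 1 for odd r ≥ 3, so 1 = 0.
module Submission where

open import Defs
open import Level using (Level)
open import Algebra.Bundles using (CommutativeRing)
open import Data.Nat using (ℕ; zero; suc; _≤_; s≤s)
import Data.Nat as ℕ
open import Data.Nat.Properties using (<⇒≤)
open import Data.Product using (_,_)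
open import Relation.Nullary using (¬_)
import Algebra.Properties.CommutativeSemigroup as CommutativeSemigroupProperties
import Algebra.Properties.Semiring.Mult as SemiringMult
import Relation.Binary.Reasoning.Setoid as SetoidReasoning

module PolynomialArithmetic {c ℓ : Level} (R : CommutativeRing c ℓ) where
  open CommutativeRing R renaming (Carrier to A)
  open Poly3 R
  open CommutativeSemigroupProperties +-commutativeSemigroup using (interchange)

  sumTo-cong : ∀ n {f g : ℕ → A} → (∀ a → f a ≈ g a) → sumTo n f ≈ sumTo n g
  sumTo-cong zero    f≈g = f≈g 0
  sumTo-cong (suc n) f≈g = +-cong (sumTo-cong n f≈g) (f≈g (suc n))

  sumTo-zero : ∀ n {f : ℕ → A} → (∀ a → f a ≈ 0#) → sumTo n f ≈ 0#
  sumTo-zero zero    f≈0 = f≈0 0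
  sumTo-zero (suc n) f≈0 = trans (+-cong (sumTo-zero n f≈0) (f≈0 (suc n))) (+-identityˡ 0#)

  sumTo-head : ∀ n {f : ℕ → A} → (∀ a → f (suc a) ≈ 0#) → sumTo n f ≈ f 0
  sumTo-head zero    tail≈0 = refl
  sumTo-head (suc n) tail≈0 = trans (+-cong (sumTo-head n tail≈0) (tail≈0 n)) (+-identityʳ _)

  sumTo-unfoldˡ : ∀ n (f : ℕ → A) → sumTo (suc n) f ≈ f 0 + sumTo n (λ a → f (suc a))
  sumTo-unfoldˡ zero    f = refl
  sumTo-unfoldˡ (suc n) f = trans (+-cong (sumTo-unfoldˡ n f) refl) (+-assoc _ _ _)

  sumTo-+ : ∀ n (f g : ℕ → A) → sumTo n (λ a → f a + g a) ≈ sumTo n f + sumTo n g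
  sumTo-+ zero    f g = refl
  sumTo-+ (suc n) f g = trans (+-cong (sumTo-+ n f g) refl) (interchange _ _ _ _)

  ≋-sym : ∀ {P Q} → P ≋ Q → Q ≋ P
  ≋-sym P≋Q i j k = sym (P≋Q i j k)

  ≋-trans : ∀ {P Q S} → P ≋ Q → Q ≋ S → P ≋ S
  ≋-trans P≋Q Q≋S i j k = trans (P≋Q i j k) (Q≋S i j k)

  ⊕-cong : ∀ {P P₁ Q Q₁} → P ≋ P₁ → Q ≋ Q₁ → P ⊕ Q ≋ P₁ ⊕ Q₁
  ⊕-cong P≋P₁ Q≋Q₁ i j k = +-cong (P≋P₁ i j k) (Q≋Q₁ i j k)

  ⊗-congʳ : ∀ {P P₁} Q → P ≋ P₁ → P ⊗ Q ≋ P₁ ⊗ Q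
  ⊗-congʳ Q P≋P₁ i j k =
    sumTo-cong i λ a → sumTo-cong j λ b → sumTo-cong k λ e → *-cong (P≋P₁ a b e) refl

  ⊗-distribʳ-⊕ : ∀ P Q S → (P ⊕ Q) ⊗ S ≋ P ⊗ S ⊕ Q ⊗ S
  ⊗-distribʳ-⊕ P Q S i j k =
    trans (sumTo-cong i λ a →
      trans (sumTo-cong j λ b →
        trans (sumTo-cong k λ e → distribʳ _ _ _) (sumTo-+ k _ _))
        (sumTo-+ j _ _))
      (sumTo-+ i _ _)

  one-sucˣ : ∀ a b e → one (suc a) b e ≈ 0#
  one-sucˣ a b e = trans (*-cong (zeroˡ _) refl) (zeroˡ _)

  one-sucʸ : ∀ a b e → one a (suc b) e ≈ 0#
  one-sucʸ a b e = trans (*-cong (zeroʳ _) refl) (zeroˡ _)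

  one-sucᶻ : ∀ a b e → one a b (suc e) ≈ 0#
  one-sucᶻ a b e = zeroʳ _

  one-000 : one 0 0 0 ≈ 1#
  one-000 = trans (*-identityʳ _) (*-identityʳ _)

  ⊗-identityˡ : ∀ P → one ⊗ P ≋ P
  ⊗-identityˡ P i j k =
    trans (sumTo-head i λ a → sumTo-zero j λ b → sumTo-zero k λ e → killed (one-sucˣ a b e))
    (trans (sumTo-head j λ b → sumTo-zero k λ e → killed (one-sucʸ 0 b e))
    (trans (sumTo-head k λ e → killed (one-sucᶻ 0 0 e))
      (trans (*-cong one-000 refl) (*-identityˡ _))))
    where
    killed : ∀ {x y} → x ≈ 0# → x * y ≈ 0#
    killed x≈0 = trans (*-cong x≈0 refl) (zeroˡ _)

  mulX mulY mulZ : Coeffs → Coeffs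
  mulX P zero    j k = 0#
  mulX P (suc i) j k = P i j k
  mulY P i zero    k = 0#
  mulY P i (suc j) k = P i j k
  mulZ P i j zero    = 0#
  mulZ P i j (suc k) = P i j k

  mulX-cong : ∀ {P Q} → P ≋ Q → mulX P ≋ mulX Q
  mulX-cong P≋Q zero    j k = refl
  mulX-cong P≋Q (suc i) j k = P≋Q i j k

  mulY-cong : ∀ {P Q} → P ≋ Q → mulY P ≋ mulY Q
  mulY-cong P≋Q i zero    k = refl
  mulY-cong P≋Q i (suc j) k = P≋Q i j k

  mulZ-cong : ∀ {P Q} → P ≋ Q → mulZ P ≋ mulZ Q
  mulZ-cong P≋Q i j zero    = refl
  mulZ-cong P≋Q i j (suc k) = P≋Q i j k

  mulX-⊗ : ∀ P Q → mulX P ⊗ Q ≋ mulX (P ⊗ Q)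
  mulX-⊗ P Q zero    j k = sumTo-zero j λ b → sumTo-zero k λ e → zeroˡ _
  mulX-⊗ P Q (suc i) j k =
    trans (sumTo-unfoldˡ i _)
      (trans (+-cong (sumTo-zero j λ b → sumTo-zero k λ e → zeroˡ _) refl) (+-identityˡ _))

  mulY-⊗ : ∀ P Q → mulY P ⊗ Q ≋ mulY (P ⊗ Q)
  mulY-⊗ P Q i zero    k = sumTo-zero i λ a → sumTo-zero k λ e → zeroˡ _
  mulY-⊗ P Q i (suc j) k = sumTo-cong i λ a →
    trans (sumTo-unfoldˡ j _)
      (trans (+-cong (sumTo-zero k λ e → zeroˡ _) refl) (+-identityˡ _))

  mulZ-⊗ : ∀ P Q → mulZ P ⊗ Q ≋ mulZ (P ⊗ Q)
  mulZ-⊗ P Q i j zero    = sumTo-zero i λ a → sumTo-zero j λ b → zeroˡ _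
  mulZ-⊗ P Q i j (suc k) = sumTo-cong i λ a → sumTo-cong j λ b →
    trans (sumTo-unfoldˡ k _) (trans (+-cong (zeroˡ _) refl) (+-identityˡ _))

  X≋mulX-one : X ≋ mulX one
  X≋mulX-one zero          j k = one-sucˣ 0 j k
  X≋mulX-one (suc zero)    j k = refl
  X≋mulX-one (suc (suc i)) j k = refl

  Y≋mulY-one : Y ≋ mulY one
  Y≋mulY-one i zero          k = one-sucʸ i 0 k
  Y≋mulY-one i (suc zero)    k = refl
  Y≋mulY-one i (suc (suc j)) k = refl

  Z≋mulZ-one : Z ≋ mulZ one
  Z≋mulZ-one i j zero          = one-sucᶻ i j 0
  Z≋mulZ-one i j (suc zero)    = refl
  Z≋mulZ-one i j (suc (suc k)) = refl

  X⊗≋mulX : ∀ P → X ⊗ P ≋ mulX P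
  X⊗≋mulX P = ≋-trans (⊗-congʳ P X≋mulX-one) (≋-trans (mulX-⊗ one P) (mulX-cong (⊗-identityˡ P)))

  Y⊗≋mulY : ∀ P → Y ⊗ P ≋ mulY P
  Y⊗≋mulY P = ≋-trans (⊗-congʳ P Y≋mulY-one) (≋-trans (mulY-⊗ one P) (mulY-cong (⊗-identityˡ P)))

  Z⊗≋mulZ : ∀ P → Z ⊗ P ≋ mulZ P
  Z⊗≋mulZ P = ≋-trans (⊗-congʳ P Z≋mulZ-one) (≋-trans (mulZ-⊗ one P) (mulZ-cong (⊗-identityˡ P)))

  -- Associativity of ⊗ is only needed with a linear form on the left.
  AssociatesOnLeft : Coeffs → Set (c Level.⊔ ℓ)
  AssociatesOnLeft L = ∀ P Q → (L ⊗ P) ⊗ Q ≋ L ⊗ (P ⊗ Q)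

  X-associatesOnLeft : AssociatesOnLeft X
  X-associatesOnLeft P Q =
    ≋-trans (⊗-congʳ Q (X⊗≋mulX P)) (≋-trans (mulX-⊗ P Q) (≋-sym (X⊗≋mulX (P ⊗ Q))))

  Y-associatesOnLeft : AssociatesOnLeft Y
  Y-associatesOnLeft P Q =
    ≋-trans (⊗-congʳ Q (Y⊗≋mulY P)) (≋-trans (mulY-⊗ P Q) (≋-sym (Y⊗≋mulY (P ⊗ Q))))

  Z-associatesOnLeft : AssociatesOnLeft Z
  Z-associatesOnLeft P Q =
    ≋-trans (⊗-congʳ Q (Z⊗≋mulZ P)) (≋-trans (mulZ-⊗ P Q) (≋-sym (Z⊗≋mulZ (P ⊗ Q))))

  ⊕-associatesOnLeft : ∀ {L M} → AssociatesOnLeft L → AssociatesOnLeft M → AssociatesOnLeft (L ⊕ M)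
  ⊕-associatesOnLeft {L} {M} assocL assocM P Q =
    ≋-trans (⊗-congʳ Q (⊗-distribʳ-⊕ L M P))
    (≋-trans (⊗-distribʳ-⊕ (L ⊗ P) (M ⊗ P) Q)
    (≋-trans (⊕-cong (assocL P Q) (assocM P Q)) (≋-sym (⊗-distribʳ-⊕ L M (P ⊗ Q)))))

  antidiagonalSum : ℕ → (ℕ → ℕ → A) → A
  antidiagonalSum zero    f = f 0 0
  antidiagonalSum (suc N) f = f 0 (suc N) + antidiagonalSum N (λ i j → f (suc i) j)

  antidiagonalSum-cong : ∀ N {f g : ℕ → ℕ → A} → (∀ i j → f i j ≈ g i j) →
                         antidiagonalSum N f ≈ antidiagonalSum N g
  antidiagonalSum-cong zero    f≈g = f≈g 0 0
  antidiagonalSum-cong (suc N) f≈g =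
    +-cong (f≈g 0 (suc N)) (antidiagonalSum-cong N (λ i j → f≈g (suc i) j))

  antidiagonalSum-+ : ∀ N (f g : ℕ → ℕ → A) →
    antidiagonalSum N (λ i j → f i j + g i j) ≈ antidiagonalSum N f + antidiagonalSum N g
  antidiagonalSum-+ zero    f g = refl
  antidiagonalSum-+ (suc N) f g =
    trans (+-cong refl (antidiagonalSum-+ N _ _)) (interchange _ _ _ _)

  antidiagonalSum-zero : ∀ N {f : ℕ → ℕ → A} → (∀ i j → f i j ≈ 0#) → antidiagonalSum N f ≈ 0#
  antidiagonalSum-zero zero    f≈0 = f≈0 0 0
  antidiagonalSum-zero (suc N) f≈0 =
    trans (+-cong (f≈0 0 (suc N)) (antidiagonalSum-zero N (λ i j → f≈0 (suc i) j))) (+-identityˡ 0#)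

  antidiagonalSum-unfoldʳ : ∀ N (f : ℕ → ℕ → A) →
    antidiagonalSum (suc N) f ≈ antidiagonalSum N (λ i j → f i (suc j)) + f (suc N) 0
  antidiagonalSum-unfoldʳ zero    f = refl
  antidiagonalSum-unfoldʳ (suc N) f =
    trans (+-cong refl (antidiagonalSum-unfoldʳ N (λ i j → f (suc i) j))) (sym (+-assoc _ _ _))

module Char2Evaluation {c ℓ : Level} (R : CommutativeRing c ℓ) (char2 : HasChar2 R) where
  open CommutativeRing R renaming (Carrier to A)
  open Poly3 R
  open PolynomialArithmetic R
  open SemiringMult semiring using (_×_; ×-homo-+; ×-homo-1; ×-assocˡ)
  open SetoidReasoning setoid

  x+x≈0 : ∀ x → x + x ≈ 0#
  x+x≈0 x = begin
    x + x            ≈⟨ sym (+-cong (*-identityˡ x) (*-identityˡ x)) ⟩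
    1# * x + 1# * x  ≈⟨ sym (distribʳ x 1# 1#) ⟩
    (1# + 1#) * x    ≈⟨ *-cong char2 refl ⟩
    0# * x           ≈⟨ zeroˡ x ⟩
    0#               ∎

  odd×1≈1 : ∀ m → (2 ℕ.* m ℕ.+ 1) × 1# ≈ 1#
  odd×1≈1 m = begin
    (2 ℕ.* m ℕ.+ 1) × 1#        ≈⟨ ×-homo-+ 1# (2 ℕ.* m) 1 ⟩
    (2 ℕ.* m) × 1# + 1 × 1#     ≈⟨ +-cong (sym (×-assocˡ 1# 2 m)) (×-homo-1 1#) ⟩
    2 × (m × 1#) + 1#           ≈⟨ +-cong (+-cong refl (+-identityʳ _)) refl ⟩
    m × 1# + m × 1# + 1#        ≈⟨ +-cong (x+x≈0 _) refl ⟩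
    0# + 1#                     ≈⟨ +-identityˡ 1# ⟩
    1#                          ∎

  -- The value at (1,1,0), and the value of ∂/∂x at (1,1,0), of the homogeneous
  -- component of degree N. Restricting to one degree keeps the sums finite.
  ev ∂ₓev : ℕ → Coeffs → A
  ev   N P = antidiagonalSum N (λ i j → P i j 0)
  ∂ₓev N P = antidiagonalSum N (λ i j → (i × 1#) * P i j 0)

  ev-cong : ∀ N {P Q} → P ≋ Q → ev N P ≈ ev N Q
  ev-cong N P≋Q = antidiagonalSum-cong N (λ i j → P≋Q i j 0)

  ∂ₓev-cong : ∀ N {P Q} → P ≋ Q → ∂ₓev N P ≈ ∂ₓev N Q
  ∂ₓev-cong N P≋Q = antidiagonalSum-cong N (λ i j → *-cong refl (P≋Q i j 0))

  ev-⊕ : ∀ N P Q → ev N (P ⊕ Q) ≈ ev N P + ev N Q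
  ev-⊕ N P Q = antidiagonalSum-+ N _ _

  ∂ₓev-⊕ : ∀ N P Q → ∂ₓev N (P ⊕ Q) ≈ ∂ₓev N P + ∂ₓev N Q
  ∂ₓev-⊕ N P Q = trans (antidiagonalSum-cong N (λ i j → distribˡ _ _ _)) (antidiagonalSum-+ N _ _)

  ev-mulX : ∀ N P → ev (suc N) (mulX P) ≈ ev N P
  ev-mulX N P = +-identityˡ _

  ev-mulY : ∀ N P → ev (suc N) (mulY P) ≈ ev N P
  ev-mulY N P = trans (antidiagonalSum-unfoldʳ N (λ i j → mulY P i j 0)) (+-identityʳ _)

  ev-mulZ : ∀ N P → ev N (mulZ P) ≈ 0#
  ev-mulZ N P = antidiagonalSum-zero N (λ i j → refl)

  ∂ₓev-mulX : ∀ N P → ∂ₓev (suc N) (mulX P) ≈ ev N P + ∂ₓev N P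
  ∂ₓev-mulX N P =
    trans (trans (+-cong (zeroˡ _) refl) (+-identityˡ _))
    (trans (antidiagonalSum-cong N (λ i j → trans (distribʳ _ _ _) (+-cong (*-identityˡ _) refl)))
      (antidiagonalSum-+ N _ _))

  ∂ₓev-mulY : ∀ N P → ∂ₓev (suc N) (mulY P) ≈ ∂ₓev N P
  ∂ₓev-mulY N P =
    trans (antidiagonalSum-unfoldʳ N (λ i j → (i × 1#) * mulY P i j 0))
      (trans (+-cong refl (zeroʳ _)) (+-identityʳ _))

  ∂ₓev-mulZ : ∀ N P → ∂ₓev N (mulZ P) ≈ 0#
  ∂ₓev-mulZ N P = antidiagonalSum-zero N (λ i j → zeroʳ _)

  record Vanishes (P : Coeffs) : Set ℓ where
    constructor vanishing
    field ev≈0 : ∀ N → ev N P ≈ 0#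
  open Vanishes

  vanishes-cong : ∀ {P Q} → P ≋ Q → Vanishes P → Vanishes Q
  vanishes-cong P≋Q P≈0 = vanishing λ N → trans (sym (ev-cong N P≋Q)) (ev≈0 P≈0 N)

  vanishes-⊕ : ∀ {P Q} → Vanishes P → Vanishes Q → Vanishes (P ⊕ Q)
  vanishes-⊕ {P} {Q} P≈0 Q≈0 = vanishing λ N →
    trans (ev-⊕ N P Q) (trans (+-cong (ev≈0 P≈0 N) (ev≈0 Q≈0 N)) (+-identityˡ 0#))

  vanishes-mulX : ∀ {P} → Vanishes P → Vanishes (mulX P)
  vanishes-mulX {P} P≈0 = vanishing λ where
    zero    → refl
    (suc N) → trans (ev-mulX N P) (ev≈0 P≈0 N)

  vanishes-mulY : ∀ {P} → Vanishes P → Vanishes (mulY P)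
  vanishes-mulY {P} P≈0 = vanishing λ where
    zero    → refl
    (suc N) → trans (ev-mulY N P) (ev≈0 P≈0 N)

  vanishes-Z⊗ : ∀ P → Vanishes (Z ⊗ P)
  vanishes-Z⊗ P = vanishing λ N → trans (ev-cong N (Z⊗≋mulZ P)) (ev-mulZ N P)

  vanishes-[X+Z]⊗ : ∀ {P} → Vanishes P → Vanishes ((X ⊕ Z) ⊗ P)
  vanishes-[X+Z]⊗ {P} P≈0 = vanishes-cong (≋-sym (⊗-distribʳ-⊕ X Z P))
    (vanishes-⊕ (vanishes-cong (≋-sym (X⊗≋mulX P)) (vanishes-mulX P≈0)) (vanishes-Z⊗ P))

  vanishes-[Y+Z]⊗ : ∀ {P} → Vanishes P → Vanishes ((Y ⊕ Z) ⊗ P)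
  vanishes-[Y+Z]⊗ {P} P≈0 = vanishes-cong (≋-sym (⊗-distribʳ-⊕ Y Z P))
    (vanishes-⊕ (vanishes-cong (≋-sym (Y⊗≋mulY P)) (vanishes-mulY P≈0)) (vanishes-Z⊗ P))

  [X+Y]⊗≋ : ∀ P → (X ⊕ Y) ⊗ P ≋ mulX P ⊕ mulY P
  [X+Y]⊗≋ P = ≋-trans (⊗-distribʳ-⊕ X Y P) (⊕-cong (X⊗≋mulX P) (Y⊗≋mulY P))

  vanishes-mulX⊕mulY : ∀ P → Vanishes (mulX P ⊕ mulY P)
  vanishes-mulX⊕mulY P = vanishing λ where
    zero    → +-identityʳ 0#
    (suc N) → begin
      ev (suc N) (mulX P ⊕ mulY P)              ≈⟨ ev-⊕ (suc N) (mulX P) (mulY P) ⟩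
      ev (suc N) (mulX P) + ev (suc N) (mulY P) ≈⟨ +-cong (ev-mulX N P) (ev-mulY N P) ⟩
      ev N P + ev N P                           ≈⟨ x+x≈0 _ ⟩
      0#                                        ∎

  vanishes-[X+Y]⊗ : ∀ P → Vanishes ((X ⊕ Y) ⊗ P)
  vanishes-[X+Y]⊗ P = vanishes-cong (≋-sym ([X+Y]⊗≋ P)) (vanishes-mulX⊕mulY P)

  -- Leibniz rule, with ∂ₓ(x+y) = 1 and the two ∂ₓev N P terms cancelling.
  ∂ₓev-[X+Y]⊗ : ∀ N P → ∂ₓev (suc N) ((X ⊕ Y) ⊗ P) ≈ ev N P
  ∂ₓev-[X+Y]⊗ N P = begin
    ∂ₓev (suc N) ((X ⊕ Y) ⊗ P)                   ≈⟨ ∂ₓev-cong (suc N) ([X+Y]⊗≋ P) ⟩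
    ∂ₓev (suc N) (mulX P ⊕ mulY P)               ≈⟨ ∂ₓev-⊕ (suc N) (mulX P) (mulY P) ⟩
    ∂ₓev (suc N) (mulX P) + ∂ₓev (suc N) (mulY P) ≈⟨ +-cong (∂ₓev-mulX N P) (∂ₓev-mulY N P) ⟩
    ev N P + ∂ₓev N P + ∂ₓev N P                 ≈⟨ +-assoc _ _ _ ⟩
    ev N P + (∂ₓev N P + ∂ₓev N P)               ≈⟨ +-cong refl (x+x≈0 _) ⟩
    ev N P + 0#                                  ≈⟨ +-identityʳ _ ⟩
    ev N P                                       ∎

  ∂ₓev-Z⊗ : ∀ N P → ∂ₓev N (Z ⊗ P) ≈ 0#
  ∂ₓev-Z⊗ N P = trans (∂ₓev-cong N (Z⊗≋mulZ P)) (∂ₓev-mulZ N P)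

  vanishes-[X+Y+Z]⊗ : ∀ P → Vanishes ((X ⊕ Y ⊕ Z) ⊗ P)
  vanishes-[X+Y+Z]⊗ P = vanishes-cong (≋-sym (⊗-distribʳ-⊕ (X ⊕ Y) Z P))
    (vanishes-⊕ (vanishes-[X+Y]⊗ P) (vanishes-Z⊗ P))

  ∂ₓev-[X+Y+Z]⊗ : ∀ N P → ∂ₓev (suc N) ((X ⊕ Y ⊕ Z) ⊗ P) ≈ ev N P
  ∂ₓev-[X+Y+Z]⊗ N P =
    trans (∂ₓev-cong (suc N) (⊗-distribʳ-⊕ (X ⊕ Y) Z P))
    (trans (∂ₓev-⊕ (suc N) ((X ⊕ Y) ⊗ P) (Z ⊗ P))
    (trans (+-cong (∂ₓev-[X+Y]⊗ N P) (∂ₓev-Z⊗ (suc N) P)) (+-identityʳ _)))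

  ev-X^ : ∀ n → ev n (X ^^ n) ≈ 1#
  ev-X^ zero    = one-000
  ev-X^ (suc n) = trans (ev-cong (suc n) (X⊗≋mulX (X ^^ n))) (trans (ev-mulX n (X ^^ n)) (ev-X^ n))

  ∂ₓev-X^ : ∀ n → ∂ₓev n (X ^^ n) ≈ n × 1#
  ∂ₓev-X^ zero    = zeroˡ _
  ∂ₓev-X^ (suc n) =
    trans (∂ₓev-cong (suc n) (X⊗≋mulX (X ^^ n)))
      (trans (∂ₓev-mulX n (X ^^ n)) (+-cong (ev-X^ n) (∂ₓev-X^ n)))

  ∂ₓev-Y^ : ∀ n → ∂ₓev n (Y ^^ n) ≈ 0#
  ∂ₓev-Y^ zero    = zeroˡ _
  ∂ₓev-Y^ (suc n) =
    trans (∂ₓev-cong (suc n) (Y⊗≋mulY (Y ^^ n))) (trans (∂ₓev-mulY n (Y ^^ n)) (∂ₓev-Y^ n))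

  ∂ₓev-[X+Y+Z]^ : ∀ n → ∂ₓev (2 ℕ.+ n) ((X ⊕ Y ⊕ Z) ^^ (2 ℕ.+ n)) ≈ 0#
  ∂ₓev-[X+Y+Z]^ n =
    trans (∂ₓev-[X+Y+Z]⊗ (suc n) ((X ⊕ Y ⊕ Z) ^^ suc n))
      (ev≈0 (vanishes-[X+Y+Z]⊗ ((X ⊕ Y ⊕ Z) ^^ n)) (suc n))

  ∂ₓev-numer : ∀ r → 2 ≤ r → ∂ₓev r (numer r) ≈ r × 1#
  ∂ₓev-numer zero          ()
  ∂ₓev-numer (suc zero)    (s≤s ())
  ∂ₓev-numer r@(suc (suc n)) _ = begin
    ∂ₓev r (numer r)
      ≈⟨ ∂ₓev-⊕ r (X ^^ r ⊕ Y ^^ r ⊕ Z ^^ r) ((X ⊕ Y ⊕ Z) ^^ r) ⟩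
    ∂ₓev r (X ^^ r ⊕ Y ^^ r ⊕ Z ^^ r) + ∂ₓev r ((X ⊕ Y ⊕ Z) ^^ r)
      ≈⟨ +-cong (∂ₓev-⊕ r (X ^^ r ⊕ Y ^^ r) (Z ^^ r)) (∂ₓev-[X+Y+Z]^ n) ⟩
    ∂ₓev r (X ^^ r ⊕ Y ^^ r) + ∂ₓev r (Z ^^ r) + 0#
      ≈⟨ +-identityʳ _ ⟩
    ∂ₓev r (X ^^ r ⊕ Y ^^ r) + ∂ₓev r (Z ^^ r)
      ≈⟨ +-cong (∂ₓev-⊕ r (X ^^ r) (Y ^^ r)) (∂ₓev-Z⊗ r (Z ^^ suc n)) ⟩
    ∂ₓev r (X ^^ r) + ∂ₓev r (Y ^^ r) + 0#
      ≈⟨ +-identityʳ _ ⟩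
    ∂ₓev r (X ^^ r) + ∂ₓev r (Y ^^ r)
      ≈⟨ +-cong (∂ₓev-X^ r) (∂ₓev-Y^ r) ⟩
    r × 1# + 0#
      ≈⟨ +-identityʳ _ ⟩
    r × 1#
      ∎

  -- denom ⊗ φ = (x+y) · ((x+z)(y+z)φ), and the cofactor vanishes at (1,1,0)
  -- along with φ, so ∂ₓev kills it by the Leibniz rule.
  ∂ₓev-denom⊗ : ∀ {φ} → Vanishes φ → ∀ N → ∂ₓev N (denom ⊗ φ) ≈ 0#
  ∂ₓev-denom⊗         φ≈0 zero    = zeroˡ _
  ∂ₓev-denom⊗ {φ} φ≈0 (suc N) = begin
    ∂ₓev (suc N) (denom ⊗ φ)                    ≈⟨ ∂ₓev-cong (suc N) denom⊗φ≋ ⟩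
    ∂ₓev (suc N) ((X ⊕ Y) ⊗ ((V ⊗ W) ⊗ φ))      ≈⟨ ∂ₓev-[X+Y]⊗ N ((V ⊗ W) ⊗ φ) ⟩
    ev N ((V ⊗ W) ⊗ φ)                          ≈⟨ ev≈0 (vanishes-cong (≋-sym V⊗W⊗φ≋) cofactor≈0) N ⟩
    0#                                          ∎
    where
    V W : Coeffs
    V = X ⊕ Z
    W = Y ⊕ Z
    [X+Y]-assoc : AssociatesOnLeft (X ⊕ Y)
    [X+Y]-assoc = ⊕-associatesOnLeft X-associatesOnLeft Y-associatesOnLeft
    denom⊗φ≋ : denom ⊗ φ ≋ (X ⊕ Y) ⊗ ((V ⊗ W) ⊗ φ)
    denom⊗φ≋ = ≋-trans (⊗-congʳ φ ([X+Y]-assoc V W)) ([X+Y]-assoc (V ⊗ W) φ)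
    V⊗W⊗φ≋ : (V ⊗ W) ⊗ φ ≋ V ⊗ (W ⊗ φ)
    V⊗W⊗φ≋ = ⊕-associatesOnLeft X-associatesOnLeft Z-associatesOnLeft W φ
    cofactor≈0 : Vanishes (V ⊗ (W ⊗ φ))
    cofactor≈0 = vanishes-[X+Z]⊗ (vanishes-[Y+Z]⊗ φ≈0)

open import Data.Nat using (_*_; _+_)

lemma6p1 : {c ℓ : Level} (R : CommutativeRing c ℓ) → IsField R → HasChar2 R →
    (m : ℕ) → let r = 2 * m + 1 in 3 ≤ r →
    (φ : Poly3.Coeffs R) → Poly3.IsPhi R r φ →
    ¬ (Poly3._∣P_ R (Poly3._⊕_ R (Poly3.X R) (Poly3.Y R)) φ)
lemma6p1 R isField char2 m 3≤r φ (_ , denom⊗φ≋numer) (q , _ , φ≋[X+Y]⊗q) =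
  IsField.1≉0 isField (begin
    1#                   ≈⟨ sym (odd×1≈1 m) ⟩
    r × 1#               ≈⟨ sym (∂ₓev-numer r (<⇒≤ 3≤r)) ⟩
    ∂ₓev r (numer r)     ≈⟨ sym (∂ₓev-cong r denom⊗φ≋numer) ⟩
    ∂ₓev r (denom ⊗ φ)   ≈⟨ ∂ₓev-denom⊗ φ≈0 r ⟩
    0#                   ∎)
  where
  open CommutativeRing R using (1#; 0#; semiring; setoid; sym)
  open Poly3 R using (numer; denom; _⊗_)
  open PolynomialArithmetic R using (≋-sym)
  open Char2Evaluation R char2
  open SemiringMult semiring using (_×_)
  open SetoidReasoning setoid
  r : ℕ
  r = 2 * m + 1
  φ≈0 : Vanishes φ
  φ≈0 = vanishes-cong (≋-sym φ≋[X+Y]⊗q) (vanishes-[X+Y]⊗ q)
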